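{- Let $t\ge 5$ be odd and $1\le n\le m$. If a non-adaptive $(m,s,t)$-graph $G$ is admissible for sets of size at most $n$, then the query scheme $\mathcal{T}_G$ is satisfiable for every set $S\subseteq[m]$ with $|S|\le n$.
   Context: A non-adaptive $(m,s,t)$-graph is a bipartite graph $G$ with vertex sets $U=[m]$ and $V$, $|V|=ts$, where $V$ is partitioned into disjoint sets $V_1,\ldots,V_t$ of $s$ vertices each and every $u\in U$ has exactly one neighbour in each $V_i$. For $R\subseteq[m]$, $\Gamma_G(R)$ is the set of neighbours of $R$ in $G$ ($\Gamma_G(y)=\Gamma_G(\{y\})$). The query scheme $\mathcal{T}_G$: the memory is an array $L$ of $ts$ bits indexed by $V$; the query "Is $u$ in $S$?" is answered Yes iff the majority of the $t$ locations in $\Gamma_G(u)$ contain 1. $\mathcal{T}_G$ is satisfiable for $S\subseteq[m]$ if there is an assignment $(L[v]:v\in V)$ under which every query "Is $x$ in $S$?", $x\in[m]$, is answered correctly. $G$ is admissible for sets of size at most $n$ if (P1) for all $R\subseteq[m]$ with $|R|\le n+\lceil 2n\lg\frac{2m}{n}\rceil$: $|\Gamma_G(R)|\ge\frac{t+1}{2}|R|$; and (P2) for all $S\subseteq[m]$ with $|S|=n$: $|T_S|\le\lceil 2n\lg\frac{2m}{n}\rceil$, where $T_S=\{y\in[m]\setminus S: |\Gamma_G(y)\cap\Gamma_G(S)|\ge\frac{t+1}{2}\}$. $\lg$ is base 2. -}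

module Defs where

open import Data.Nat using (ℕ; zero; suc; _+_; _*_; _^_; _≤_; _<_)
open import Data.Bool using (Bool; true; false; _∧_; _∨_; if_then_else_)
open import Data.Fin using (Fin; zero; suc; _≟_)
open import Data.Fin.Subset using (Subset; _∈_; _∉_; ∣_∣)
open import Data.Vec using (lookup)
open import Data.Product using (_×_)
open import Relation.Nullary.Decidable using (⌊_⌋)

count : (k : ℕ) → (Fin k → Bool) → ℕ
count zero    p = 0
count (suc k) p = (if p zero then 1 else 0) + count k (λ i → p (suc i))

sumFin : (k : ℕ) → (Fin k → ℕ) → ℕ
sumFin zero    f = 0
sumFin (suc k) f = f zero + sumFin k (λ i → f (suc i))

anyFin : (k : ℕ) → (Fin k → Bool) → Bool
anyFin zero    p = false
anyFin (suc k) p = p zero ∨ anyFin k (λ i → p (suc i))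

-- A non-adaptive (m,s,t)-graph: V = V_1 ∪ … ∪ V_t, V_i ≅ Fin s, so V ≅ Fin t × Fin s.
-- Each u ∈ [m] (≅ Fin m) has exactly one neighbour in each V_i, namely (i , nbr u i).
record NonAdaptiveGraph (m s t : ℕ) : Set where
  field
    nbr : Fin m → Fin t → Fin s
open NonAdaptiveGraph public

module _ {m s t : ℕ} (G : NonAdaptiveGraph m s t) where

  inΓ : Subset m → Fin t → Fin s → Bool
  inΓ R i j = anyFin m (λ u → lookup R u ∧ ⌊ nbr G u i ≟ j ⌋)

  ∣Γ∣ : Subset m → ℕ
  ∣Γ∣ R = sumFin t (λ i → count s (λ j → inΓ R i j))

  ∣Γy∩ΓS∣ : Fin m → Subset m → ℕ
  ∣Γy∩ΓS∣ y S = count t (λ i → inΓ S i (nbr G y i))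

  ∣T∣ : Subset m → ℕ
  ∣T∣ S = count m (λ y → (Data.Bool.not (lookup S y)) ∧ ⌊ (t + 1) Data.Nat.≤? (2 * ∣Γy∩ΓS∣ y S) ⌋)

  -- Admissibility for sets of size at most n, with K = ⌈2n lg(2m/n)⌉
  Admissible : (n K : ℕ) → Set
  Admissible n K =
    ((R : Subset m) → ∣ R ∣ ≤ n + K → (t + 1) * ∣ R ∣ ≤ 2 * ∣Γ∣ R)   -- (P1)
    × ((S : Subset m) → ∣ S ∣ ≡ n → ∣T∣ S ≤ K)                         -- (P2)
    where open import Relation.Binary.PropositionalEquality using (_≡_)

  -- The query scheme T_G: with memory L (indexed by V = Fin t × Fin s),
  -- "Is x in S?" is answered Yes iff the majority of the t locations Γ_G(x)
  -- contain 1, i.e. 2 · #{i : L[i , nbr x i] = 1} > t.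
  answerYes : (Fin t → Fin s → Bool) → Fin m → Set
  answerYes L x = t < 2 * count t (λ i → L i (nbr G x i))

  Satisfiable : Subset m → Set
  Satisfiable S = Σ (Fin t → Fin s → Bool) λ L →
    (x : Fin m) → (answerYes L x → x ∈ S) × (x ∈ S → answerYes L x)
    where open import Data.Product using (Σ)

-- K is ⌈2n lg(2m/n)⌉ (for n ≥ 1). For a natural k:
--   k ≥ 2n lg(2m/n)  ⇔  2^k ≥ (2m/n)^(2n)  ⇔  (2m)^(2n) ≤ 2^k · n^(2n),
-- so the ceiling is the least k with this property.
IsCeil2nLg : (n m K : ℕ) → Set
IsCeil2nLg n m K =
  ((2 * m) ^ (2 * n) ≤ 2 ^ K * n ^ (2 * n))
  × ((k : ℕ) → (2 * m) ^ (2 * n) ≤ 2 ^ k * n ^ (2 * n) → K ≤ k)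

module Submission where

-- Extend S to a set S' of exactly n elements and put R = S' ∪ T_{S'}. By (P2), |R| ≤ n + K, so by
-- (P1) every subset of R has at least (t+1)/2 times as many neighbours as elements, and Hall's
-- theorem (via Rado's edge-deletion argument) gives each x ∈ R a set of (t+1)/2 private locations in
-- Γ(x), lying in distinct blocks V_i. Store 1 exactly in the locations of Γ(S) that are not private
-- to an element outside S. An element of S reads 1 at its private locations; an element of R ∖ S
-- reads 0 at its private locations; and an element y ∉ R, not being in T_{S'}, meets Γ(S) ⊆ Γ(S')
-- in fewer than (t+1)/2 locations. So the majority answer is always correct.

open import Defs
open import Data.Nat using (ℕ; zero; suc; _+_; _*_; _≤_; _<_; z≤n; s≤s; _≤?_; _<?_)
open import Data.Nat.Properties hiding (_≟_; suc-injective)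
open import Data.Bool using (Bool; true; false; _∧_; _∨_; not; if_then_else_)
open import Data.Bool.Properties
  using (∧-conicalˡ; ∧-conicalʳ; ∨-conicalˡ; ∨-conicalʳ; ∨-zeroʳ; ∧-identityʳ; ∧-zeroʳ; not-injective)
open import Data.Fin using (Fin; zero; suc; _≟_; _↑ˡ_; _↑ʳ_; combine; remQuot; fromℕ<)
open import Data.Fin.Properties
  using ( suc-injective; injective⇒≤; fromℕ<-injective; any?
        ; remQuot-combine; combine-remQuot; combine-injectiveʳ)
open import Data.Fin.Subset using (Subset; ∣_∣; _∈_; _⊆_; ⊤)
open import Data.Fin.Subset.Properties using (s⊆s; ⊆⊤; ∣⊤∣≡n; anySubset?)
open import Data.Vec using ([]; _∷_; lookup; tabulate)
open import Data.Vec.Properties using (lookup∘tabulate; []=⇒lookup; lookup⇒[]=)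
open import Data.Nat.Tactic.RingSolver using (solve-∀)
open import Data.Product using (Σ; ∃; ∃₂; _×_; _,_; proj₁; proj₂)
open import Data.Sum using (_⊎_; inj₁; inj₂)
open import Function.Definitions using (Injective)
open import Relation.Nullary using (¬_; Dec; yes; no; contradiction)
open import Relation.Nullary.Decidable using (⌊_⌋; isYes≗does; dec-true; dec-false; toSum)
open import Relation.Binary.PropositionalEquality
open import Function using (_∘_)
open import Induction.WellFounded using (Acc; acc)
open import Data.Nat.Induction using (<-wellFounded)
open import Data.Empty using (⊥; ⊥-elim)

∧-intro : ∀ {a b} → a ≡ true → b ≡ true → a ∧ b ≡ true
∧-intro = cong₂ _∧_

∨-introˡ : ∀ {a} b → a ≡ true → a ∨ b ≡ true
∨-introˡ b = cong (_∨ b)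

∨-introʳ : ∀ a {b} → b ≡ true → a ∨ b ≡ true
∨-introʳ a b≡true = trans (cong (a ∨_) b≡true) (∨-zeroʳ a)

∨-elim : ∀ a {b} → a ∨ b ≡ true → a ≡ true ⊎ b ≡ true
∨-elim true  _ = inj₁ refl
∨-elim false e = inj₂ e

from-⌊⌋ : ∀ {A : Set} (a? : Dec A) → ⌊ a? ⌋ ≡ true → A
from-⌊⌋ (yes a) _ = a

from-⌊⌋-false : ∀ {A : Set} (a? : Dec A) → ⌊ a? ⌋ ≡ false → ¬ A
from-⌊⌋-false (no ¬a) _ = ¬a

to-⌊⌋ : ∀ {A : Set} (a? : Dec A) → A → ⌊ a? ⌋ ≡ true
to-⌊⌋ a? a = trans (isYes≗does a?) (dec-true a? a)

to-⌊⌋-false : ∀ {A : Set} (a? : Dec A) → ¬ A → ⌊ a? ⌋ ≡ false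
to-⌊⌋-false a? ¬a = trans (isYes≗does a?) (dec-false a? ¬a)

_==_ : ∀ {k} → Fin k → Fin k → Bool
i == j = ⌊ i ≟ j ⌋

-- Counting Boolean predicates on Fin k

count-cong : ∀ k {p q : Fin k → Bool} → (∀ i → p i ≡ q i) → count k p ≡ count k q
count-cong zero    p≡q = refl
count-cong (suc k) p≡q rewrite p≡q zero = cong (_ +_) (count-cong k (λ i → p≡q (suc i)))

count-true : ∀ k → count k (λ _ → true) ≡ k
count-true zero    = refl
count-true (suc k) = cong suc (count-true k)

count-not : ∀ k (p : Fin k → Bool) → count k p + count k (λ i → not (p i)) ≡ k
count-not zero    p = refl
count-not (suc k) p with p zero
... | true  = cong suc (count-not k _)
... | false = trans (+-suc _ _) (cong suc (count-not k _))

enum : ∀ {k} (p : Fin k → Bool) → Fin (count k p) → Fin k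
enum {suc k} p e with p zero
enum {suc k} p zero    | true  = zero
enum {suc k} p (suc e) | true  = suc (enum (λ i → p (suc i)) e)
enum {suc k} p e       | false = suc (enum (λ i → p (suc i)) e)

enum-sound : ∀ {k} (p : Fin k → Bool) e → p (enum p e) ≡ true
enum-sound {suc k} p e with p zero in p₀
enum-sound {suc k} p zero    | true  = p₀
enum-sound {suc k} p (suc e) | true  = enum-sound (λ i → p (suc i)) e
enum-sound {suc k} p e       | false = enum-sound (λ i → p (suc i)) e

enum-injective : ∀ {k} (p : Fin k → Bool) {e e'} → enum p e ≡ enum p e' → e ≡ e'
enum-injective {suc k} p {e} {e'} eq with p zero
enum-injective {suc k} p {zero}  {zero}   eq | true  = refl
enum-injective {suc k} p {suc e} {suc e'} eq | true  =
  cong suc (enum-injective (λ i → p (suc i)) (suc-injective eq))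
enum-injective {suc k} p {e}     {e'}     eq | false =
  enum-injective (λ i → p (suc i)) (suc-injective eq)

rank : ∀ {k} (p : Fin k → Bool) i → p i ≡ true → Fin (count k p)
rank {suc k} p zero    pᵢ with p zero
rank {suc k} p zero    refl | true = zero
rank {suc k} p (suc i) pᵢ with p zero
... | true  = suc (rank (λ i → p (suc i)) i pᵢ)
... | false = rank (λ i → p (suc i)) i pᵢ

enum-rank : ∀ {k} (p : Fin k → Bool) i (pᵢ : p i ≡ true) → enum p (rank p i pᵢ) ≡ i
enum-rank {suc k} p zero    pᵢ with p zero
enum-rank {suc k} p zero    refl | true = refl
enum-rank {suc k} p (suc i) pᵢ with p zero
... | true  = cong suc (enum-rank (λ i → p (suc i)) i pᵢ)
... | false = cong suc (enum-rank (λ i → p (suc i)) i pᵢ)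

count-≤-injection : ∀ {k l} (p : Fin k → Bool) (q : Fin l → Bool) (g : Fin k → Fin l) →
  (∀ i → p i ≡ true → q (g i) ≡ true) →
  (∀ i j → p i ≡ true → p j ≡ true → g i ≡ g j → i ≡ j) →
  count k p ≤ count l q
count-≤-injection p q g g-into g-injective = injective⇒≤ φ-injective
  where
  φ : Fin (count _ p) → Fin (count _ q)
  φ e = rank q (g (enum p e)) (g-into _ (enum-sound p e))
  φ-injective : Injective _≡_ _≡_ φ
  φ-injective {e} {e'} φe≡φe' = enum-injective p
    (g-injective _ _ (enum-sound p e) (enum-sound p e')
      (trans (sym (enum-rank q _ _)) (trans (cong (enum q) φe≡φe') (enum-rank q _ _))))

count-mono : ∀ k {p q : Fin k → Bool} → (∀ i → p i ≡ true → q i ≡ true) → count k p ≤ count k q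
count-mono k {p} {q} p⊆q = count-≤-injection p q (λ i → i) p⊆q (λ _ _ _ _ i≡j → i≡j)

count-≥1 : ∀ k (p : Fin k → Bool) i → p i ≡ true → 1 ≤ count k p
count-≥1 k p i pᵢ = count-≤-injection (λ _ → true) p (λ _ → i) (λ _ _ → pᵢ) injective
  where
  injective : (c c' : Fin 1) → _ → _ → i ≡ i → c ≡ c'
  injective zero zero _ _ _ = refl

count-≥2 : ∀ k (p : Fin k → Bool) {i j} → i ≢ j → p i ≡ true → p j ≡ true → 2 ≤ count k p
count-≥2 k p {i} {j} i≢j pᵢ pⱼ = count-≤-injection (λ _ → true) p pair pair-into pair-injective
  where
  pair : Fin 2 → Fin k
  pair zero    = i
  pair (suc _) = j
  pair-into : ∀ c → true ≡ true → p (pair c) ≡ true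
  pair-into zero    _ = pᵢ
  pair-into (suc _) _ = pⱼ
  pair-injective : ∀ c c' → _ → _ → pair c ≡ pair c' → c ≡ c'
  pair-injective zero          zero          _ _ _   = refl
  pair-injective zero          (suc zero)    _ _ i≡j = contradiction i≡j i≢j
  pair-injective (suc zero)    zero          _ _ j≡i = contradiction (sym j≡i) i≢j
  pair-injective (suc zero)    (suc zero)    _ _ _   = refl

count-≤1 : ∀ k (p : Fin k → Bool) i → (∀ j → p j ≡ true → j ≡ i) → count k p ≤ 1
count-≤1 k p i only-i = count-≤-injection {l = 1} p (λ _ → true) (λ _ → zero) (λ _ _ → refl)
  (λ j j' pⱼ pⱼ' _ → trans (only-i j pⱼ) (sym (only-i j' pⱼ')))

count-≤1⇒unique : ∀ k (p : Fin k → Bool) {i j} →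
  count k p ≤ 1 → p i ≡ true → p j ≡ true → i ≡ j
count-≤1⇒unique k p {i} {j} ≤1 pᵢ pⱼ with i ≟ j
... | yes i≡j = i≡j
... | no  i≢j = contradiction (≤-trans (count-≥2 k p i≢j pᵢ pⱼ) ≤1) (λ { (s≤s ()) })

count>0⇒∃ : ∀ k (p : Fin k → Bool) → 0 < count k p → ∃ λ i → p i ≡ true
count>0⇒∃ k p 0<count = enum p (fromℕ< 0<count) , enum-sound p _

count≥2⇒distinct : ∀ k (p : Fin k → Bool) → 2 ≤ count k p →
  ∃₂ λ i j → i ≢ j × p i ≡ true × p j ≡ true
count≥2⇒distinct k p 2≤count =
  enum p e₀ , enum p e₁ , e₀≢e₁ ∘ enum-injective p , enum-sound p e₀ , enum-sound p e₁
  where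
  e₀ e₁ : Fin (count k p)
  e₀ = fromℕ< (≤-trans (s≤s z≤n) 2≤count)
  e₁ = fromℕ< 2≤count
  e₀≢e₁ : e₀ ≢ e₁
  e₀≢e₁ e₀≡e₁ = contradiction (fromℕ<-injective 0 1 _ _ e₀≡e₁) (λ ())

count-∨+count-∧ : ∀ k (p q : Fin k → Bool) →
  count k (λ i → p i ∨ q i) + count k (λ i → p i ∧ q i) ≡ count k p + count k q
count-∨+count-∧ zero    p q = refl
count-∨+count-∧ (suc k) p q
  with p zero | q zero | count-∨+count-∧ k (λ i → p (suc i)) (λ i → q (suc i))
... | true  | true  | ih = cong suc (trans (+-suc _ _) (trans (cong suc ih) (sym (+-suc _ _))))
... | true  | false | ih = cong suc ih
... | false | true  | ih = trans (cong suc ih) (sym (+-suc _ _))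
... | false | false | ih = ih

count-∨≤ : ∀ k (p q : Fin k → Bool) → count k (λ i → p i ∨ q i) ≤ count k p + count k q
count-∨≤ k p q = ≤-trans (m≤m+n _ _) (≤-reflexive (count-∨+count-∧ k p q))

count-< : ∀ k {p q : Fin k → Bool} → (∀ i → p i ≡ true → q i ≡ true) →
  ∀ i → p i ≡ false → q i ≡ true → count k p < count k q
count-< (suc k) {p} {q} p⊆q zero p₀ q₀ rewrite p₀ | q₀ =
  s≤s (count-mono k (λ i → p⊆q (suc i)))
count-< (suc k) {p} {q} p⊆q (suc i) pᵢ qᵢ =
  +-mono-≤-< (bit-mono (p zero) (q zero) (p⊆q zero)) (count-< k (λ i → p⊆q (suc i)) i pᵢ qᵢ)
  where
  bit-mono : ∀ a b → (a ≡ true → b ≡ true) → (if a then 1 else 0) ≤ (if b then 1 else 0)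
  bit-mono false _ _   = z≤n
  bit-mono true  b a⇒b rewrite a⇒b refl = ≤-refl

anyFin⇒∃ : ∀ k (p : Fin k → Bool) → anyFin k p ≡ true → ∃ λ i → p i ≡ true
anyFin⇒∃ (suc k) p any with p zero in p₀
... | true  = zero , p₀
... | false with anyFin⇒∃ k (λ i → p (suc i)) any
...   | i , pᵢ = suc i , pᵢ

∃⇒anyFin : ∀ k (p : Fin k → Bool) i → p i ≡ true → anyFin k p ≡ true
∃⇒anyFin (suc k) p zero    p₀ = ∨-introˡ _ p₀
∃⇒anyFin (suc k) p (suc i) pᵢ = ∨-introʳ (p zero) (∃⇒anyFin k (λ i → p (suc i)) i pᵢ)

anyFin-cong : ∀ k {p q : Fin k → Bool} → (∀ i → p i ≡ q i) → anyFin k p ≡ anyFin k q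
anyFin-cong zero    p≡q = refl
anyFin-cong (suc k) p≡q = cong₂ _∨_ (p≡q zero) (anyFin-cong k (λ i → p≡q (suc i)))

∣∣≡count : ∀ {k} (R : Subset k) → ∣ R ∣ ≡ count k (lookup R)
∣∣≡count []          = refl
∣∣≡count (true  ∷ R) = cong suc (∣∣≡count R)
∣∣≡count (false ∷ R) = ∣∣≡count R

sumFin-mono : ∀ k {f g : Fin k → ℕ} → (∀ i → f i ≤ g i) → sumFin k f ≤ sumFin k g
sumFin-mono zero    f≤g = z≤n
sumFin-mono (suc k) f≤g = +-mono-≤ (f≤g zero) (sumFin-mono k (λ i → f≤g (suc i)))

sumFin-< : ∀ k {f g : Fin k → ℕ} → (∀ i → f i ≤ g i) →
  ∀ i → f i < g i → sumFin k f < sumFin k g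
sumFin-< (suc k) f≤g zero    fᵢ<gᵢ = +-mono-<-≤ fᵢ<gᵢ (sumFin-mono k (λ i → f≤g (suc i)))
sumFin-< (suc k) f≤g (suc i) fᵢ<gᵢ =
  +-mono-≤-< (f≤g zero) (sumFin-< k (λ i → f≤g (suc i)) i fᵢ<gᵢ)

count-++ : ∀ a b (p : Fin (a + b) → Bool) →
  count (a + b) p ≡ count a (λ i → p (i ↑ˡ b)) + count b (λ j → p (a ↑ʳ j))
count-++ zero    b p = refl
count-++ (suc a) b p =
  trans (cong (bit +_) (count-++ a b (λ i → p (suc i)))) (sym (+-assoc bit _ _))
  where bit = if p zero then 1 else 0

count-combine : ∀ a b (p : Fin (a * b) → Bool) →
  count (a * b) p ≡ sumFin a (λ i → count b (λ j → p (combine i j)))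
count-combine zero    b p = refl
count-combine (suc a) b p =
  trans (count-++ b (a * b) p)
        (cong (count b (λ j → p (j ↑ˡ a * b)) +_) (count-combine a b (λ j → p (b ↑ʳ j))))

sumFin-count≤*count-anyFin : ∀ a b (p : Fin a → Fin b → Bool) →
  sumFin a (λ i → count b (p i)) ≤ b * count a (λ i → anyFin b (p i))
sumFin-count≤*count-anyFin zero    b p = ≤-reflexive (sym (*-zeroʳ b))
sumFin-count≤*count-anyFin (suc a) b p =
  ≤-trans (+-mono-≤ (row≤ (p zero)) (sumFin-count≤*count-anyFin a b (λ i → p (suc i))))
          (≤-reflexive (sym (*-distribˡ-+ b _ _)))
  where
  row≤ : (q : Fin b → Bool) → count b q ≤ b * (if anyFin b q then 1 else 0)
  row≤ q with anyFin b q in any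
  ... | true  = ≤-trans (count-mono b (λ _ _ → refl))
                        (≤-reflexive (trans (count-true b) (sym (*-identityʳ b))))
  ... | false = subst (count b q ≤_) (sym (*-zeroʳ b)) (≮⇒≥ λ 0<count →
    let j , qⱼ = count>0⇒∃ b q 0<count
    in contradiction (trans (sym any) (∃⇒anyFin b q j qⱼ)) λ ())

⊆-extend : ∀ {m n} (S : Subset m) → ∣ S ∣ ≤ n → n ≤ m → ∃ λ S' → S ⊆ S' × ∣ S' ∣ ≡ n
⊆-extend [] z≤n z≤n = [] , (λ x∈S → x∈S) , refl
⊆-extend (true ∷ S) (s≤s ∣S∣≤n) (s≤s n≤m) with ⊆-extend S ∣S∣≤n n≤m
... | S' , S⊆S' , ∣S'∣≡n = true ∷ S' , s⊆s S⊆S' , cong suc ∣S'∣≡n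
⊆-extend {suc m} {n} (false ∷ S) ∣S∣≤n n≤1+m with n ≤? m
... | yes n≤m = let S' , S⊆S' , ∣S'∣≡n = ⊆-extend S ∣S∣≤n n≤m
              in false ∷ S' , s⊆s S⊆S' , ∣S'∣≡n
... | no  n≰m = ⊤ , ⊆⊤ , trans (∣⊤∣≡n (suc m)) (≤-antisym (≰⇒> n≰m) n≤1+m)

-- Hall's theorem

module _ {a b : ℕ} where

  neighbourhood : (Fin a → Fin b → Bool) → (Fin a → Bool) → Fin b → Bool
  neighbourhood E p v = anyFin a (λ u → p u ∧ E u v)

  HallCondition : (Fin a → Fin b → Bool) → Set
  HallCondition E = ∀ p → count a p ≤ count b (neighbourhood E p)

  Deficient : (Fin a → Fin b → Bool) → (Fin a → Bool) → Set
  Deficient E p = count b (neighbourhood E p) < count a p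

  Matching : (Fin a → Fin b → Bool) → Set
  Matching E = Σ (Fin a → Fin b) λ f → (∀ u → E u (f u) ≡ true) × Injective _≡_ _≡_ f

  neighbourhood-intro : ∀ E p {u v} → p u ≡ true → E u v ≡ true → neighbourhood E p v ≡ true
  neighbourhood-intro E p {u} pᵤ Eᵤᵥ = ∃⇒anyFin a _ u (∧-intro pᵤ Eᵤᵥ)

  neighbourhood-elim : ∀ E {p v} → neighbourhood E p v ≡ true →
    ∃ λ u → p u ≡ true × E u v ≡ true
  neighbourhood-elim E N with anyFin⇒∃ a _ N
  ... | u , pᵤ∧Eᵤᵥ = u , ∧-conicalˡ _ _ pᵤ∧Eᵤᵥ , ∧-conicalʳ _ _ pᵤ∧Eᵤᵥ

  neighbourhood-mono : ∀ {E E'} {p q : Fin a → Bool} →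
    (∀ u v → p u ≡ true → E u v ≡ true → q u ≡ true × E' u v ≡ true) →
    ∀ v → neighbourhood E p v ≡ true → neighbourhood E' q v ≡ true
  neighbourhood-mono {E} {E'} step v N with neighbourhood-elim E N
  ... | u , pᵤ , Eᵤᵥ = let qᵤ , E'ᵤᵥ = step u v pᵤ Eᵤᵥ in neighbourhood-intro E' _ qᵤ E'ᵤᵥ

  hallCondition⊎deficient : ∀ E → HallCondition E ⊎ ∃ (Deficient E)
  hallCondition⊎deficient E
    with anySubset? (λ B → count b (neighbourhood E (lookup B)) <? count a (lookup B))
  ... | yes (B , deficient) = inj₂ (lookup B , deficient)
  ... | no  ¬deficient = inj₁ λ p → subst₂ _≤_
    (count-cong a (lookup∘tabulate p))
    (count-cong b λ v → anyFin-cong a λ u → cong (_∧ E u v) (lookup∘tabulate p u))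
    (≮⇒≥ λ deficient → ¬deficient (tabulate p , deficient))

  Matching-⊆ : ∀ {E E'} → (∀ u v → E' u v ≡ true → E u v ≡ true) → Matching E' → Matching E
  Matching-⊆ E'⊆E (f , f-edge , f-injective) =
    f , (λ u → E'⊆E u (f u) (f-edge u)) , f-injective

  remove : (Fin a → Fin b → Bool) → Fin a → Fin b → Fin a → Fin b → Bool
  remove E x y u v = E u v ∧ not (u == x ∧ v == y)

  remove⊆ : ∀ E x y u v → remove E x y u v ≡ true → E u v ≡ true
  remove⊆ E x y u v = ∧-conicalˡ (E u v) _

  remove-≢ˡ : ∀ E {x y u} v → u ≢ x → remove E x y u v ≡ E u v
  remove-≢ˡ E {x} {u = u} v u≢x rewrite to-⌊⌋-false (u ≟ x) u≢x = ∧-identityʳ (E u v)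

  remove-≢ʳ : ∀ E {x y} u {v} → v ≢ y → remove E x y u v ≡ E u v
  remove-≢ʳ E {x} {y} u {v} v≢y rewrite to-⌊⌋-false (v ≟ y) v≢y | ∧-zeroʳ (u == x) =
    ∧-identityʳ (E u v)

  remove-removed : ∀ E x y → remove E x y x y ≡ false
  remove-removed E x y rewrite to-⌊⌋ (x ≟ x) refl | to-⌊⌋ (y ≟ y) refl = ∧-zeroʳ (E x y)

  edges : (Fin a → Fin b → Bool) → ℕ
  edges E = sumFin a (λ u → count b (E u))

  edges-remove : ∀ E {x y} → E x y ≡ true → edges (remove E x y) < edges E
  edges-remove E {x} {y} Exy = sumFin-< a (λ u → count-mono b (remove⊆ E x y u)) x
    (count-< b (remove⊆ E x y x) y (remove-removed E x y) Exy)

  Deficient-remove⇒∋ : ∀ E {x y} p → HallCondition E → Deficient (remove E x y) p → p x ≡ true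
  Deficient-remove⇒∋ E {x} {y} p hall deficient with p x in pₓ
  ... | true  = refl
  ... | false =
    contradiction (≤-trans (hall p) (count-mono b (neighbourhood-mono keep))) (<⇒≱ deficient)
    where
    keep : ∀ u v → p u ≡ true → E u v ≡ true → p u ≡ true × remove E x y u v ≡ true
    keep u v pᵤ Eᵤᵥ =
      pᵤ , trans (remove-≢ˡ E v λ { refl → contradiction (trans (sym pᵤ) pₓ) λ () }) Eᵤᵥ

  module _ (E : Fin a → Fin b → Bool) {u : Fin a} {v₁ v₂ : Fin b} (v₁≢v₂ : v₁ ≢ v₂)
           (p₁ p₂ : Fin a → Bool) (p₁ᵤ : p₁ u ≡ true) (p₂ᵤ : p₂ u ≡ true) where

    private
      N₁ N₂ : Fin b → Bool
      N₁ = neighbourhood (remove E u v₁) p₁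
      N₂ = neighbourhood (remove E u v₂) p₂

    neighbourhood-∨ : ∀ v → neighbourhood E (λ w → p₁ w ∨ p₂ w) v ≡ true → N₁ v ∨ N₂ v ≡ true
    neighbourhood-∨ v N with neighbourhood-elim E N
    ... | w , p₁ʷ∨p₂ʷ , Eʷᵥ with toSum (w ≟ u)
    ...   | inj₂ w≢u with ∨-elim (p₁ w) p₁ʷ∨p₂ʷ
    ...     | inj₁ p₁ʷ = ∨-introˡ (N₂ v) (neighbourhood-intro (remove E u v₁) p₁ p₁ʷ
                           (trans (remove-≢ˡ E {y = v₁} v w≢u) Eʷᵥ))
    ...     | inj₂ p₂ʷ = ∨-introʳ (N₁ v) (neighbourhood-intro (remove E u v₂) p₂ p₂ʷ
                           (trans (remove-≢ˡ E {y = v₂} v w≢u) Eʷᵥ))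
    neighbourhood-∨ v N | w , _ , Eʷᵥ | inj₁ refl with toSum (v ≟ v₁)
    ...   | inj₂ v≢v₁ = ∨-introˡ (N₂ v) (neighbourhood-intro (remove E u v₁) p₁ p₁ᵤ
                          (trans (remove-≢ʳ E {x = u} u v≢v₁) Eʷᵥ))
    ...   | inj₁ refl = ∨-introʳ (N₁ v) (neighbourhood-intro (remove E u v₂) p₂ p₂ᵤ
                          (trans (remove-≢ʳ E {x = u} u v₁≢v₂) Eʷᵥ))

    neighbourhood-∧ : ∀ v → neighbourhood E (λ w → (p₁ w ∧ p₂ w) ∧ not (w == u)) v ≡ true →
      N₁ v ∧ N₂ v ≡ true
    neighbourhood-∧ v N with neighbourhood-elim E N
    ... | w , pʷ , Eʷᵥ = ∧-intro
      (neighbourhood-intro (remove E u v₁) p₁ (∧-conicalˡ _ _ p₁ʷ∧p₂ʷ)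
        (trans (remove-≢ˡ E {y = v₁} v w≢u) Eʷᵥ))
      (neighbourhood-intro (remove E u v₂) p₂ (∧-conicalʳ _ _ p₁ʷ∧p₂ʷ)
        (trans (remove-≢ˡ E {y = v₂} v w≢u) Eʷᵥ))
      where
      p₁ʷ∧p₂ʷ : p₁ w ∧ p₂ w ≡ true
      p₁ʷ∧p₂ʷ = ∧-conicalˡ _ _ pʷ
      w≢u : w ≢ u
      w≢u = from-⌊⌋-false (w ≟ u) (not-injective (∧-conicalʳ _ _ pʷ))

  -- Both deficient sets contain u, and submodularity of the neighbourhood size on p₁ ∪ p₂ and
  -- p₁ ∩ p₂ ∖ {u} then contradicts Hall's condition for E.
  removals-not-both-deficient : ∀ E {u v₁ v₂} → HallCondition E → v₁ ≢ v₂ →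
    ∀ {p₁ p₂} → Deficient (remove E u v₁) p₁ → Deficient (remove E u v₂) p₂ → ⊥
  removals-not-both-deficient E {u} {v₁} {v₂} hall v₁≢v₂ {p₁} {p₂} d₁ d₂ =
    <-irrefl refl (≤-pred sandwich)
    where
    n₁ = count b (neighbourhood (remove E u v₁) p₁)
    n₂ = count b (neighbourhood (remove E u v₂) p₂)
    p₁ᵤ = Deficient-remove⇒∋ E p₁ hall d₁
    p₂ᵤ = Deficient-remove⇒∋ E p₂ hall d₂
    cup cap cap⁻ : Fin a → Bool
    cup w  = p₁ w ∨ p₂ w
    cap w  = p₁ w ∧ p₂ w
    cap⁻ w = cap w ∧ not (w == u)

    cap≤ : count a cap ≤ 1 + count b (neighbourhood E cap⁻)
    cap≤ = ≤-trans (count-mono a split) (≤-trans (count-∨≤ a (_== u) cap⁻)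
      (+-mono-≤ (count-≤1 a (_== u) u (λ w → from-⌊⌋ (w ≟ u))) (hall cap⁻)))
      where
      split : ∀ w → cap w ≡ true → (w == u) ∨ cap⁻ w ≡ true
      split w capʷ with w == u
      ... | true  = refl
      ... | false = trans (∧-identityʳ _) capʷ

    neighbourhoods≤ : count b (neighbourhood E cup) + count b (neighbourhood E cap⁻) ≤ n₁ + n₂
    neighbourhoods≤ = ≤-trans
      (+-mono-≤ (count-mono b (neighbourhood-∨ E {u} v₁≢v₂ p₁ p₂ p₁ᵤ p₂ᵤ))
                (count-mono b (neighbourhood-∧ E {u} v₁≢v₂ p₁ p₂ p₁ᵤ p₂ᵤ)))
      (≤-reflexive (count-∨+count-∧ b _ _))

    sandwich : 2 + (n₁ + n₂) ≤ 1 + (n₁ + n₂)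
    sandwich = begin
      2 + (n₁ + n₂)                 ≡⟨ cong suc (+-suc n₁ n₂) ⟨
      suc n₁ + suc n₂               ≤⟨ +-mono-≤ d₁ d₂ ⟩
      count a p₁ + count a p₂       ≡⟨ count-∨+count-∧ a p₁ p₂ ⟨
      count a cup + count a cap     ≤⟨ +-mono-≤ (hall cup) cap≤ ⟩
      count b (neighbourhood E cup) + (1 + count b (neighbourhood E cap⁻))
                                    ≡⟨ +-suc _ _ ⟩
      1 + (count b (neighbourhood E cup) + count b (neighbourhood E cap⁻))
                                    ≤⟨ s≤s neighbourhoods≤ ⟩
      1 + (n₁ + n₂)                 ∎
      where open ≤-Reasoning

  matching-of-degree≤1 : ∀ E → HallCondition E → (∀ u → count b (E u) ≤ 1) → Matching E
  matching-of-degree≤1 E hall deg≤1 = f , f-edge , f-injective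
    where
    neighbour : ∀ u → ∃ λ v → E u v ≡ true
    neighbour u = count>0⇒∃ b (E u) (≤-trans (count-≥1 a (_== u) u (to-⌊⌋ (u ≟ u) refl))
      (≤-trans (hall (_== u)) (count-mono b own-edge)))
      where
      own-edge : ∀ v → neighbourhood E (_== u) v ≡ true → E u v ≡ true
      own-edge v N with neighbourhood-elim E N
      ... | w , w==u , Eʷᵥ = subst (λ w → E w v ≡ true) (from-⌊⌋ (w ≟ u) w==u) Eʷᵥ

    f : Fin a → Fin b
    f u = proj₁ (neighbour u)

    f-edge : ∀ u → E u (f u) ≡ true
    f-edge u = proj₂ (neighbour u)

    f-injective : Injective _≡_ _≡_ f
    f-injective {u} {u'} fu≡fu' with u ≟ u'
    ... | yes u≡u' = u≡u'
    ... | no  u≢u' = contradiction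
      (≤-trans (count-≥2 a pair u≢u' (∨-introˡ _ (to-⌊⌋ (u ≟ u) refl))
                                     (∨-introʳ (u' == u) (to-⌊⌋ (u' ≟ u') refl)))
               (≤-trans (hall pair) (count-≤1 b _ (f u) only-fu)))
      λ { (s≤s ()) }
      where
      pair : Fin a → Bool
      pair w = (w == u) ∨ (w == u')
      only-fu : ∀ v → neighbourhood E pair v ≡ true → v ≡ f u
      only-fu v N with neighbourhood-elim E N
      ... | w , w∈pair , Eʷᵥ with ∨-elim (w == u) w∈pair
      ...   | inj₁ w==u  = count-≤1⇒unique b (E u) (deg≤1 u)
                             (subst (λ w → E w v ≡ true) (from-⌊⌋ (w ≟ u) w==u) Eʷᵥ) (f-edge u)
      ...   | inj₂ w==u' = trans (count-≤1⇒unique b (E u') (deg≤1 u')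
                             (subst (λ w → E w v ≡ true) (from-⌊⌋ (w ≟ u') w==u') Eʷᵥ) (f-edge u'))
                             (sym fu≡fu')

  -- Rado: as long as some vertex has two edges, one of them can be deleted keeping Hall's
  -- condition; once all degrees are at most 1, the edges themselves form the matching.
  hall-acc : ∀ E → Acc _<_ (edges E) → HallCondition E → Matching E
  hall-acc E (acc smaller) hallE with any? (λ u → 2 ≤? count b (E u))
  ... | no ¬branching =
        matching-of-degree≤1 E hallE λ u → ≤-pred (≰⇒> λ 2≤degᵤ → ¬branching (u , 2≤degᵤ))
  ... | yes (u , 2≤degᵤ) with count≥2⇒distinct b (E u) 2≤degᵤ
  ...   | v₁ , v₂ , v₁≢v₂ , Eᵤᵥ₁ , Eᵤᵥ₂
        with hallCondition⊎deficient (remove E u v₁) | hallCondition⊎deficient (remove E u v₂)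
  ...     | inj₁ hall₁ | _ =
            Matching-⊆ (remove⊆ E u v₁) (hall-acc _ (smaller (edges-remove E Eᵤᵥ₁)) hall₁)
  ...     | inj₂ _ | inj₁ hall₂ =
            Matching-⊆ (remove⊆ E u v₂) (hall-acc _ (smaller (edges-remove E Eᵤᵥ₂)) hall₂)
  ...     | inj₂ (_ , d₁) | inj₂ (_ , d₂) =
            ⊥-elim (removals-not-both-deficient E hallE v₁≢v₂ d₁ d₂)

  hall : ∀ E → HallCondition E → Matching E
  hall E = hall-acc E (<-wellFounded (edges E))

-- Private neighbours

module _ {m s t : ℕ} (G : NonAdaptiveGraph m s t) where

  inΓ-intro : ∀ R {u} i → lookup R u ≡ true → inΓ G R i (nbr G u i) ≡ true
  inΓ-intro R {u} i Rᵤ = ∃⇒anyFin m _ u (∧-intro Rᵤ (to-⌊⌋ (nbr G u i ≟ nbr G u i) refl))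

  inΓ-elim : ∀ R {i j} → inΓ G R i j ≡ true → ∃ λ u → lookup R u ≡ true × nbr G u i ≡ j
  inΓ-elim R {i} {j} Γᵢⱼ with anyFin⇒∃ m _ Γᵢⱼ
  ... | u , Rᵤ∧uᵢ==j =
    u , ∧-conicalˡ _ _ Rᵤ∧uᵢ==j , from-⌊⌋ (nbr G u i ≟ j) (∧-conicalʳ _ _ Rᵤ∧uᵢ==j)

  Expanding : (Fin m → Bool) → ℕ → Set
  Expanding R h =
    (R' : Subset m) → (∀ x → lookup R' x ≡ true → R x ≡ true) → h * ∣ R' ∣ ≤ ∣Γ∣ G R'

  -- A slot w reserves the location (layer w , nbr G (owner w) (layer w)) of Γ(owner w).
  record PrivateNeighbours (R : Fin m → Bool) (h : ℕ) : Set where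
    field
      slots              : ℕ
      owner              : Fin slots → Fin m
      layer              : Fin slots → Fin t
      location-injective : ∀ {w w'} → layer w ≡ layer w' →
                           nbr G (owner w) (layer w) ≡ nbr G (owner w') (layer w') → w ≡ w'
      slots-of           : ∀ x → R x ≡ true → Σ (Fin h → Fin slots) λ σ →
                           Injective _≡_ _≡_ σ × ∀ c → owner (σ c) ≡ x

  -- Hall's theorem for h copies of each element of R, listed by enum R, against V ≅ Fin t × Fin s.
  module _ (R : Fin m → Bool) (h : ℕ) where

    private
      r = count m R

      owner : Fin (r * h) → Fin m
      owner w = enum R (proj₁ (remQuot {r} h w))

      owner-combine : ∀ e c → owner (combine e c) ≡ enum R e
      owner-combine e c = cong (enum R ∘ proj₁) (remQuot-combine e c)

      incidence : Fin (r * h) → Fin (t * s) → Bool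
      incidence w v = nbr G (owner w) (proj₁ (remQuot {t} s v)) == proj₂ (remQuot {t} s v)

      incidence-combine : ∀ w i j → incidence w (combine i j) ≡ (nbr G (owner w) i == j)
      incidence-combine w i j =
        cong (λ (i , j) → nbr G (owner w) i == j) (remQuot-combine {t} {s} i j)

      expanding⇒hallCondition : Expanding R h → HallCondition incidence
      expanding⇒hallCondition expanding p = begin
        count (r * h) p
          ≡⟨ count-combine r h p ⟩
        sumFin r (λ e → count h (λ c → p (combine e c)))
          ≤⟨ sumFin-count≤*count-anyFin r h _ ⟩
        h * count r U
          ≤⟨ *-monoʳ-≤ h U≤image ⟩
        h * ∣ image ∣
          ≤⟨ expanding image image⊆R ⟩
        ∣Γ∣ G image
          ≤⟨ sumFin-mono t (λ i → count-mono s (Γimage⊆ i)) ⟩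
        sumFin t (λ i → count s (λ j → neighbourhood incidence p (combine i j)))
          ≡⟨ count-combine t s _ ⟨
        count (t * s) (neighbourhood incidence p)
          ∎
        where
        open ≤-Reasoning
        U : Fin r → Bool
        U e = anyFin h (λ c → p (combine e c))
        image : Subset m
        image = tabulate λ x → anyFin r (λ e → U e ∧ (enum R e == x))

        image-elim : ∀ x → lookup image x ≡ true → ∃ λ e → U e ≡ true × enum R e ≡ x
        image-elim x x∈image with anyFin⇒∃ r _ (trans (sym (lookup∘tabulate _ x)) x∈image)
        ... | e , Uₑ∧eₓ =
          e , ∧-conicalˡ _ _ Uₑ∧eₓ , from-⌊⌋ (enum R e ≟ x) (∧-conicalʳ _ _ Uₑ∧eₓ)

        image⊆R : ∀ x → lookup image x ≡ true → R x ≡ true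
        image⊆R x x∈image with image-elim x x∈image
        ... | e , _ , refl = enum-sound R e

        U≤image : count r U ≤ ∣ image ∣
        U≤image = subst (count r U ≤_) (sym (∣∣≡count image))
          (count-≤-injection U (lookup image) (enum R) into (λ _ _ _ _ → enum-injective R))
          where
          into : ∀ e → U e ≡ true → lookup image (enum R e) ≡ true
          into e Uₑ = trans (lookup∘tabulate _ (enum R e))
            (∃⇒anyFin r _ e (∧-intro Uₑ (to-⌊⌋ (enum R e ≟ enum R e) refl)))

        Γimage⊆ : ∀ i j → inΓ G image i j ≡ true →
          neighbourhood incidence p (combine i j) ≡ true
        Γimage⊆ i j Γᵢⱼ with inΓ-elim image Γᵢⱼ
        ... | x , x∈image , xᵢ≡j with image-elim x x∈image
        ...   | e , Uₑ , refl with anyFin⇒∃ h _ Uₑ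
        ...     | c , p-ec = neighbourhood-intro incidence p p-ec (trans (incidence-combine _ i j)
                  (to-⌊⌋ (nbr G (owner (combine e c)) i ≟ j)
                         (trans (cong (λ x → nbr G x i) (owner-combine e c)) xᵢ≡j)))

    privateNeighbours : Expanding R h → PrivateNeighbours R h
    privateNeighbours expanding = record
      { slots              = r * h
      ; owner              = owner
      ; layer              = layer
      ; location-injective = λ {w} {w'} lw≡lw' nw≡nw' → f-injective
          (trans (f≡location w) (trans (cong₂ combine lw≡lw' nw≡nw') (sym (f≡location w'))))
      ; slots-of           = λ x Rₓ → combine (rank R x Rₓ) ,
          (λ {c} {c'} → combine-injectiveʳ (rank R x Rₓ) c (rank R x Rₓ) c') ,
          (λ c → trans (owner-combine _ c) (enum-rank R x Rₓ))
      }
      where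
      matching = hall incidence (expanding⇒hallCondition expanding)
      f = proj₁ matching
      f-injective = proj₂ (proj₂ matching)

      layer : Fin (r * h) → Fin t
      layer w = proj₁ (remQuot {t} s (f w))

      f≡location : ∀ w → f w ≡ combine (layer w) (nbr G (owner w) (layer w))
      f≡location w = trans (sym (combine-remQuot {t} s (f w)))
        (cong (combine (layer w)) (sym (from-⌊⌋ (_ ≟ _) (proj₁ (proj₂ matching) w))))

P1⇒Expanding : ∀ {m s} k (G : NonAdaptiveGraph m s (2 * k + 1)) {bound} (R : Fin m → Bool) →
  count m R ≤ bound →
  ((R' : Subset m) → ∣ R' ∣ ≤ bound → (2 * k + 1 + 1) * ∣ R' ∣ ≤ 2 * ∣Γ∣ G R') →
  Expanding G R (suc k)
P1⇒Expanding {m} k G R ∣R∣≤bound P1 R' R'⊆R = *-cancelˡ-≤ 2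
  (subst (_≤ 2 * ∣Γ∣ G R') (halve k ∣ R' ∣) (P1 R' (≤-trans ∣R'∣≤∣R∣ ∣R∣≤bound)))
  where
  halve : ∀ k x → (2 * k + 1 + 1) * x ≡ 2 * (suc k * x)
  halve = solve-∀
  ∣R'∣≤∣R∣ : ∣ R' ∣ ≤ count m R
  ∣R'∣≤∣R∣ = subst (_≤ count m R) (sym (∣∣≡count R')) (count-mono m R'⊆R)

-- The satisfying assignment

k<c⇒2k+1<2c : ∀ {k c} → k < c → 2 * k + 1 < 2 * c
k<c⇒2k+1<2c {k} {c} k<c = subst (_≤ 2 * c) (double-suc k) (*-monoʳ-≤ 2 k<c)
  where
  double-suc : ∀ k → 2 * suc k ≡ suc (2 * k + 1)
  double-suc = solve-∀

c≤k⇒2k+1≮2c : ∀ {k c} → c ≤ k → ¬ (2 * k + 1 < 2 * c)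
c≤k⇒2k+1≮2c {k} c≤k 2k+1<2c = <⇒≱ 2k+1<2c (≤-trans (*-monoʳ-≤ 2 c≤k) (m≤m+n (2 * k) 1))

module _ {m s : ℕ} (k : ℕ) (G : NonAdaptiveGraph m s (2 * k + 1)) where

  inT : Subset m → Fin m → Bool
  inT S y = not (lookup S y) ∧ ⌊ (2 * k + 1 + 1) ≤? (2 * ∣Γy∩ΓS∣ G y S) ⌋

  module _ (S S' : Subset m) (S⊆S' : S ⊆ S')
           (P : PrivateNeighbours G (λ y → lookup S' y ∨ inT S' y) (suc k)) where

    open PrivateNeighbours P

    reservedOutside : Fin (2 * k + 1) → Fin s → Bool
    reservedOutside i j =
      anyFin slots λ w →
        not (lookup S (owner w)) ∧ ((layer w == i) ∧ (nbr G (owner w) (layer w) == j))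

    assignment : Fin (2 * k + 1) → Fin s → Bool
    assignment i j = inΓ G S i j ∧ not (reservedOutside i j)

    ones : Fin m → ℕ
    ones x = count (2 * k + 1) (λ i → assignment i (nbr G x i))

    module OwnLayers (x : Fin m) (Rₓ : lookup S' x ∨ inT S' x ≡ true) where

      σ : Fin (suc k) → Fin slots
      σ = proj₁ (slots-of x Rₓ)

      owner-σ : ∀ c → owner (σ c) ≡ x
      owner-σ = proj₂ (proj₂ (slots-of x Rₓ))

      ownLayer : Fin (suc k) → Fin (2 * k + 1)
      ownLayer c = layer (σ c)

      ownLayer-injective : Injective _≡_ _≡_ ownLayer
      ownLayer-injective {c} {c'} lc≡lc' = proj₁ (proj₂ (slots-of x Rₓ))
        (location-injective lc≡lc' (cong₂ (nbr G) (trans (owner-σ c) (sym (owner-σ c'))) lc≡lc'))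

      reserved⇒∉S : ∀ c → reservedOutside (ownLayer c) (nbr G x (ownLayer c)) ≡ true →
        lookup S x ≡ false
      reserved⇒∉S c reserved with anyFin⇒∃ slots _ reserved
      ... | w , w-reserves =
        trans (cong (lookup S) (sym owner≡x)) (not-injective (∧-conicalˡ _ _ w-reserves))
        where
        locates :
          (layer w == ownLayer c) ∧ (nbr G (owner w) (layer w) == nbr G x (ownLayer c)) ≡ true
        locates = ∧-conicalʳ (not (lookup S (owner w))) _ w-reserves
        lw≡lc = from-⌊⌋ (layer w ≟ _) (∧-conicalˡ _ _ locates)
        owner≡x : owner w ≡ x
        owner≡x = trans (cong owner (location-injective lw≡lc
          (trans (from-⌊⌋ (_ ≟ _) (∧-conicalʳ _ _ locates))
                 (cong (λ y → nbr G y (ownLayer c)) (sym (owner-σ c)))))) (owner-σ c)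

      ∉S⇒reserved : lookup S x ≡ false →
        ∀ c → reservedOutside (ownLayer c) (nbr G x (ownLayer c)) ≡ true
      ∉S⇒reserved Sₓ c = ∃⇒anyFin slots _ (σ c)
        (∧-intro (cong not (trans (cong (lookup S) (owner-σ c)) Sₓ))
        (∧-intro (to-⌊⌋ (layer (σ c) ≟ _) refl)
                 (to-⌊⌋ (_ ≟ _) (cong (λ y → nbr G y (ownLayer c)) (owner-σ c)))))

    ones-∈S : ∀ x → lookup S x ≡ true → k < ones x
    ones-∈S x Sₓ = subst (_≤ ones x) (count-true (suc k))
      (count-≤-injection (λ _ → true) _ ownLayer one (λ _ _ _ _ → ownLayer-injective))
      where
      open OwnLayers x (∨-introˡ _ ([]=⇒lookup (S⊆S' (lookup⇒[]= x S Sₓ))))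
      one : ∀ c → true ≡ true → assignment (ownLayer c) (nbr G x (ownLayer c)) ≡ true
      one c _ with reservedOutside (ownLayer c) (nbr G x (ownLayer c)) in reserved
      ... | false = ∧-intro (inΓ-intro G S (ownLayer c) Sₓ) refl
      ... | true  = contradiction (trans (sym Sₓ) (reserved⇒∉S c reserved)) λ ()

    ones-∈R∖S : ∀ x → lookup S x ≡ false → lookup S' x ∨ inT S' x ≡ true → ones x ≤ k
    ones-∈R∖S x Sₓ Rₓ = +-cancelʳ-≤ (suc k) (ones x) k (begin
      ones x + suc k     ≤⟨ +-monoʳ-≤ (ones x) suc-k≤zeros ⟩
      ones x + count (2 * k + 1) zeros
                         ≡⟨ count-not (2 * k + 1) _ ⟩
      2 * k + 1          ≡⟨ split-odd k ⟩
      k + suc k          ∎)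
      where
      open ≤-Reasoning
      open OwnLayers x Rₓ
      split-odd : ∀ k → 2 * k + 1 ≡ k + suc k
      split-odd = solve-∀
      zeros : Fin (2 * k + 1) → Bool
      zeros i = not (assignment i (nbr G x i))
      zero-at : ∀ c → true ≡ true → zeros (ownLayer c) ≡ true
      zero-at c _ rewrite ∉S⇒reserved Sₓ c = cong not (∧-zeroʳ _)
      suc-k≤zeros : suc k ≤ count (2 * k + 1) zeros
      suc-k≤zeros = subst (_≤ count (2 * k + 1) zeros) (count-true (suc k))
        (count-≤-injection (λ _ → true) zeros ownLayer zero-at (λ _ _ _ _ → ownLayer-injective))

    ones-∉R : ∀ x → lookup S' x ∨ inT S' x ≡ false → ones x ≤ k
    ones-∉R x Rₓ = ≤-trans (count-mono (2 * k + 1) one⇒shared) shared≤k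
      where
      S'ₓ = ∨-conicalˡ (lookup S' x) _ Rₓ
      shared = ∣Γy∩ΓS∣ G x S'
      below-threshold : ¬ (2 * k + 1 + 1 ≤ 2 * shared)
      below-threshold = from-⌊⌋-false (_ ≤? _)
        (trans (sym (cong (λ b → not b ∧ ⌊ 2 * k + 1 + 1 ≤? 2 * shared ⌋) S'ₓ))
               (∨-conicalʳ (lookup S' x) _ Rₓ))
      shared≤k : shared ≤ k
      shared≤k = ≮⇒≥ λ k<shared → below-threshold
        (subst (_≤ 2 * shared) (+-comm 1 (2 * k + 1)) (k<c⇒2k+1<2c k<shared))
      one⇒shared : ∀ i → assignment i (nbr G x i) ≡ true → inΓ G S' i (nbr G x i) ≡ true
      one⇒shared i one with inΓ-elim G S (∧-conicalˡ _ _ one)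
      ... | u , Sᵤ , uᵢ≡xᵢ = subst (λ j → inΓ G S' i j ≡ true) uᵢ≡xᵢ
        (inΓ-intro G S' i ([]=⇒lookup (S⊆S' (lookup⇒[]= u S Sᵤ))))

    ones-∉S : ∀ x → lookup S x ≡ false → ones x ≤ k
    ones-∉S x Sₓ with lookup S' x ∨ inT S' x in Rₓ
    ... | true  = ones-∈R∖S x Sₓ Rₓ
    ... | false = ones-∉R x Rₓ

    satisfiable : Satisfiable G S
    satisfiable = assignment , correct
      where
      correct : ∀ x → (answerYes G assignment x → x ∈ S) × (x ∈ S → answerYes G assignment x)
      correct x with lookup S x in Sₓ
      ... | true  = (λ _ → lookup⇒[]= x S Sₓ) , (λ _ → k<c⇒2k+1<2c (ones-∈S x Sₓ))
      ... | false = (λ answered → contradiction answered (c≤k⇒2k+1≮2c (ones-∉S x Sₓ)))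
                  , (λ x∈S → contradiction (trans (sym Sₓ) ([]=⇒lookup x∈S)) λ ())

-- The hypotheses t ≥ 5 and n ≥ 1, and the value of K, play no role once (P1) and (P2) hold.
lemma1 : (m s t n : ℕ) → 5 ≤ t → (∃ λ k → t ≡ 2 * k + 1) → 1 ≤ n → n ≤ m →
    (G : NonAdaptiveGraph m s t) → (K : ℕ) → IsCeil2nLg n m K →
    Admissible G n K →
    (S : Subset m) → ∣ S ∣ ≤ n → Satisfiable G S
lemma1 m s .(2 * k + 1) n _ (k , refl) _ n≤m G K _ (P1 , P2) S ∣S∣≤n with ⊆-extend S ∣S∣≤n n≤m
... | S' , S⊆S' , ∣S'∣≡n =
  satisfiable k G S S' S⊆S' (privateNeighbours G R (suc k) (P1⇒Expanding k G R ∣R∣≤n+K P1))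
  where
  R : Fin m → Bool
  R y = lookup S' y ∨ inT k G S' y
  ∣R∣≤n+K : count m R ≤ n + K
  ∣R∣≤n+K = ≤-trans (count-∨≤ m _ _)
    (+-mono-≤ (≤-reflexive (trans (sym (∣∣≡count S')) ∣S'∣≡n)) (P2 S' ∣S'∣≡n))
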